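{- Let $\sigma$ be a finite sequence of channel actions and $x,y\in\Sigma^*$. Then there exists $x'\sqsubseteq x$ with $x'\xrightarrow{\sigma}y$ if and only if $\sigma$ is enabled from $x$ (i.e. $x\xrightarrow{\sigma}z$ for some $z$) and $y\sqsubseteq\bigl(x\cdot\mathrm{wri}(\sigma)\bigr)\ominus\mathrm{rea}(\sigma)$.
   Context: Channel actions over finite $\Sigma$ are $!w$, $?w$ ($w\in\Sigma^*$); $\mathrm{rea}(?w)=w$, $\mathrm{rea}(!w)=\epsilon$, $\mathrm{wri}(!w)=w$, $\mathrm{wri}(?w)=\epsilon$, extended to sequences by concatenation. Lossy semantics: $x\xrightarrow{!w}y$ iff $y\sqsubseteq xw$, $x\xrightarrow{?w}y$ iff $wy\sqsubseteq x$ ($\sqsubseteq$ the scattered subword ordering), extended to sequences by composition. The partial function $\ominus$ is defined by: $x\ominus\epsilon=x$; $\epsilon\ominus u$ undefined if $u\neq\epsilon$; $(ax')\ominus(au')=x'\ominus u'$; $(ax')\ominus(bu')=x'\ominus(bu')$ for letters $a\neq b$. ($x\ominus u$ is defined iff $u\sqsubseteq x$.) The condition $y\sqsubseteq(\cdots)\ominus(\cdots)$ includes that the right-hand side is defined. -}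

module Defs where

open import Data.Nat using (ℕ)
open import Data.Empty using (⊥)
open import Data.Fin using (Fin)
open import Data.Fin.Properties using (_≟_)
open import Data.List using (List; []; _∷_; _++_)
open import Data.Maybe using (Maybe; just; nothing)
open import Data.Product using (∃; _×_; _,_)
open import Relation.Nullary using (yes; no)
open import Relation.Binary.PropositionalEquality using (_≡_)
import Data.List.Relation.Binary.Sublist.Propositional as SL

Word : ℕ → Set
Word k = List (Fin k)

_⊑_ : ∀ {k} → Word k → Word k → Set
_⊑_ = SL._⊆_

data Action (k : ℕ) : Set where
  send : Word k → Action k
  recv : Word k → Action k

rea : ∀ {k} → List (Action k) → Word k
rea []              = []
rea (send w ∷ σ)    = rea σ
rea (recv w ∷ σ)    = w ++ rea σ

wri : ∀ {k} → List (Action k) → Word k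
wri []              = []
wri (send w ∷ σ)    = w ++ wri σ
wri (recv w ∷ σ)    = wri σ

Step : ∀ {k} → Word k → Action k → Word k → Set
Step x (send w) y = y ⊑ (x ++ w)
Step x (recv w) y = (w ++ y) ⊑ x

Steps : ∀ {k} → Word k → List (Action k) → Word k → Set
Steps x []      y = x ≡ y
Steps x (a ∷ σ) y = ∃ λ z → Step x a z × Steps z σ y

Enabled : ∀ {k} → Word k → List (Action k) → Set
Enabled x σ = ∃ λ z → Steps x σ z

_⊖_ : ∀ {k} → Word k → Word k → Maybe (Word k)
x        ⊖ []      = just x
[]       ⊖ (_ ∷ _) = nothing
(a ∷ x') ⊖ (b ∷ u') with a ≟ b
... | yes _ = x' ⊖ u'
... | no  _ = x' ⊖ (b ∷ u')

_⊑?_ : ∀ {k} → Word k → Maybe (Word k) → Set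
y ⊑? just m  = y ⊑ m
y ⊑? nothing = ⊥

{-# OPTIONS --safe #-}
-- The residual x ⊖ u is defined exactly when u ⊑ x and satisfies u ++ y ⊑ x ⟺ y ⊑ x ⊖ u, so the
-- right-hand side says  rea σ ++ y ⊑ x ++ wri σ.  Every lossy run x' –σ→ y with x' ⊑ x gives this
-- inequality.  Conversely (for σ = [] take x' = y), run σ from x itself, letting each receive ?w
-- consume the greedy (leftmost) embedding of w: the remainder x ⊖ w is the greatest r with
-- w ++ r ⊑ x, even after appending more sends, so the greedy choice preserves both enabledness
-- and the inequality.
module Submission where

open import Defs
open import Data.Nat using (ℕ)
open import Data.Fin.Properties using (_≟_)
open import Data.List using (List; []; _∷_; _++_)
open import Data.List.Properties using (++-assoc; ++-identityʳ)
open import Data.List.Relation.Binary.Sublist.Heterogeneous using (_∷_; _∷ʳ_)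
open import Data.List.Relation.Binary.Sublist.Propositional using (⊆-refl; ⊆-trans)
open import Data.List.Relation.Binary.Sublist.Propositional.Properties using (∷⁻; ++⁺; ++⁺ʳ; module ⊆-Reasoning)
open import Data.Maybe using (just; nothing)
open import Data.Product using (∃; _×_; _,_)
open import Function.Bundles using (_⇔_; mk⇔)
open import Relation.Binary.PropositionalEquality using (_≡_; refl; sym; subst)
open import Relation.Nullary using (yes; no; contradiction)

private
  variable
    k : ℕ
    x x' y z : Word k
    a : Action k
    σ : List (Action k)

++⊑⇒⊑?⊖ : ∀ u y {x : Word k} → (u ++ y) ⊑ x → y ⊑? (x ⊖ u)
++⊑⇒⊑?⊖ []      y         le = le
++⊑⇒⊑?⊖ (b ∷ u) y {c ∷ x} le with c ≟ b | le
... | yes refl | le′     = ++⊑⇒⊑?⊖ u y (∷⁻ le′)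
... | no  _    | _ ∷ʳ le′ = ++⊑⇒⊑?⊖ (b ∷ u) y le′
... | no  c≢b  | refl ∷ _ = contradiction refl c≢b

⊑?⊖⇒++⊑ : ∀ u y {x : Word k} → y ⊑? (x ⊖ u) → (u ++ y) ⊑ x
⊑?⊖⇒++⊑ []      y         le = le
⊑?⊖⇒++⊑ (b ∷ u) y {c ∷ x} le with c ≟ b
... | yes refl = refl ∷ ⊑?⊖⇒++⊑ u y le
... | no  _    = c ∷ʳ ⊑?⊖⇒++⊑ (b ∷ u) y le

⊖-++ʳ : ∀ (x u : Word k) {r} t → x ⊖ u ≡ just r → (x ++ t) ⊖ u ≡ just (r ++ t)
⊖-++ʳ x       []      t refl = refl
⊖-++ʳ (c ∷ x) (b ∷ u) t eq with c ≟ b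
... | yes _ = ⊖-++ʳ x u t eq
... | no  _ = ⊖-++ʳ x (b ∷ u) t eq

⊖-residual : ∀ u {x r : Word k} → x ⊖ u ≡ just r → (u ++ r) ⊑ x
⊖-residual u eq = ⊑?⊖⇒++⊑ u _ (subst (_ ⊑?_) (sym eq) ⊆-refl)

⊖-residual-greatest : ∀ u {x r v : Word k} t → x ⊖ u ≡ just r → (u ++ v) ⊑ (x ++ t) → v ⊑ (r ++ t)
⊖-residual-greatest u {x} t eq le = subst (_ ⊑?_) (⊖-++ʳ x u t eq) (++⊑⇒⊑?⊖ u _ le)

Step-mono : x' ⊑ x → Step x' a z → Step x a z
Step-mono {a = send w} x'⊑x st = ⊆-trans st (++⁺ x'⊑x ⊆-refl)
Step-mono {a = recv w} x'⊑x st = ⊆-trans st x'⊑x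

Enabled-mono : x' ⊑ x → Enabled x' σ → Enabled x σ
Enabled-mono {x = x} {σ = []}    _     _                    = x , refl
Enabled-mono         {σ = _ ∷ _} x'⊑x (y , z , st , steps) = y , z , Step-mono x'⊑x st , steps

Steps-sound : Steps x σ y → (rea σ ++ y) ⊑ (x ++ wri σ)
Steps-sound {σ = []} refl = ++⁺ʳ [] ⊆-refl
Steps-sound {x = x} {σ = send w ∷ σ} {y} (z , z⊑x++w , steps) = begin
  rea σ ++ y           ⊆⟨ Steps-sound steps ⟩
  z ++ wri σ           ⊆⟨ ++⁺ z⊑x++w ⊆-refl ⟩
  (x ++ w) ++ wri σ    ≡⟨ ++-assoc x w (wri σ) ⟩
  x ++ (w ++ wri σ)    ∎
  where open ⊆-Reasoning
Steps-sound {x = x} {σ = recv w ∷ σ} {y} (z , w++z⊑x , steps) = begin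
  (w ++ rea σ) ++ y    ≡⟨ ++-assoc w (rea σ) y ⟩
  w ++ (rea σ ++ y)    ⊆⟨ ++⁺ (⊆-refl {x = w}) (Steps-sound steps) ⟩
  w ++ (z ++ wri σ)    ≡⟨ ++-assoc w z (wri σ) ⟨
  (w ++ z) ++ wri σ    ⊆⟨ ++⁺ w++z⊑x ⊆-refl ⟩
  x ++ wri σ           ∎
  where open ⊆-Reasoning

Steps-complete : Enabled x σ → (rea σ ++ y) ⊑ (x ++ wri σ) → ∃ λ x' → x' ⊑ x × Steps x' σ y
Steps-complete {x = x} {σ = []} {y} _ y⊑x = y , subst (y ⊑_) (++-identityʳ x) y⊑x , refl
Steps-complete {x = x} {σ = send w ∷ σ} (_ , z , z⊑x++w , steps) h
  with Steps-complete (Enabled-mono z⊑x++w (_ , steps)) (subst (_ ⊑_) (sym (++-assoc x w (wri σ))) h)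
... | x″ , x″⊑x++w , steps″ = x , ⊆-refl , x″ , x″⊑x++w , steps″
Steps-complete {x = x} {σ = recv w ∷ σ} {y} (_ , z , w++z⊑x , steps) h
  with x ⊖ w in eq | ++⊑⇒⊑?⊖ w z w++z⊑x
... | nothing | ()
... | just r  | z⊑r
  with Steps-complete (Enabled-mono z⊑r (_ , steps))
         (⊖-residual-greatest w (wri σ) eq (subst (_⊑ _) (++-assoc w (rea σ) y) h))
... | x″ , x″⊑r , steps″ =
  x , ⊆-refl , x″ , ⊆-trans (++⁺ ⊆-refl x″⊑r) (⊖-residual w eq) , steps″

lemma27 : {k : ℕ} (σ : List (Action k)) (x y : Word k) →
    (∃ λ x' → (x' ⊑ x) × Steps x' σ y) ⇔ (Enabled x σ × (y ⊑? ((x ++ wri σ) ⊖ rea σ)))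
lemma27 σ x y = mk⇔
  (λ { (x' , x'⊑x , steps) →
         Enabled-mono x'⊑x (y , steps)
       , ++⊑⇒⊑?⊖ (rea σ) y (⊆-trans (Steps-sound steps) (++⁺ x'⊑x ⊆-refl)) })
  (λ { (enabled , y⊑?) → Steps-complete enabled (⊑?⊖⇒++⊑ (rea σ) y y⊑?) })
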